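{- Let $\mathbf{A}$ be a $\tau$-structure with $\mathbf{A}\subseteq L_m$ for some $m\ge 1$, and suppose there is a homomorphism $h:L_n\to\mathbf{A}$ for some $n\ge 2$. Then $L_n\cong\mathbf{A}\cong L_m$.
   Context: $\tau$ is the signature with two binary relation symbols $O,S$ and one unary relation symbol $P$. For $n\in\mathbb{N}$, $L_n$ is the $\tau$-structure with universe $\{1,\dots,n\}$, $O^{L_n}=\{(i,j):i<j\}$, $S^{L_n}=\{(i,i+1):1\le i<n\}$, and $P^{L_n}=\{1,n\}$. $\mathbf{A}\subseteq\mathbf{B}$ means $\mathbf{A}$ is a (not necessarily induced) substructure: $A\subseteq B$ and $R^{\mathbf{A}}\subseteq R^{\mathbf{B}}$ for each $R\in\tau$. A homomorphism is a map between universes preserving every relation. -}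

module Defs where

open import Data.Nat using (ℕ; zero; suc; _<_; _∸_)
open import Data.Fin using (Fin; toℕ)
open import Data.Bool using (Bool; T)
open import Data.Product using (Σ; _×_; proj₁)
open import Data.Sum using (_⊎_)
open import Relation.Binary.PropositionalEquality using (_≡_)

record Structure : Set₁ where
  field
    Carrier : Set
    O : Carrier → Carrier → Set
    S : Carrier → Carrier → Set
    P : Carrier → Set
open Structure public

-- L_n : universe {1,…,n}, represented by Fin n (element i ↦ toℕ i + 1).
L : ℕ → Structure
L n = record
  { Carrier = Fin n
  ; O = λ i j → toℕ i < toℕ j
  ; S = λ i j → toℕ j ≡ suc (toℕ i)
  ; P = λ i → (toℕ i ≡ 0) ⊎ (toℕ i ≡ n ∸ 1)
  }

record Hom (A B : Structure) : Set where
  field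
    fun : Carrier A → Carrier B
    presO : ∀ {x y} → O A x y → O B (fun x) (fun y)
    presS : ∀ {x y} → S A x y → S B (fun x) (fun y)
    presP : ∀ {x} → P A x → P B (fun x)

record Iso (A B : Structure) : Set where
  field
    to : Carrier A → Carrier B
    from : Carrier B → Carrier A
    from∘to : ∀ x → from (to x) ≡ x
    to∘from : ∀ y → to (from y) ≡ y
    presO : ∀ {x y} → O A x y → O B (to x) (to y)
    reflO : ∀ {x y} → O B (to x) (to y) → O A x y
    presS : ∀ {x y} → S A x y → S B (to x) (to y)
    reflS : ∀ {x y} → S B (to x) (to y) → S A x y
    presP : ∀ {x} → P A x → P B (to x)
    reflP : ∀ {x} → P B (to x) → P A x

-- A (not necessarily induced) substructure of B: a subset U of the universe
-- of B (given by a Bool-valued characteristic function, so it is a genuine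
-- subset), together with relations on U contained in those of B.
record Sub (B : Structure) : Set₁ where
  field
    U : Carrier B → Bool
    O' : Σ (Carrier B) (λ x → T (U x)) → Σ (Carrier B) (λ x → T (U x)) → Set
    S' : Σ (Carrier B) (λ x → T (U x)) → Σ (Carrier B) (λ x → T (U x)) → Set
    P' : Σ (Carrier B) (λ x → T (U x)) → Set
    O⊆ : ∀ {x y} → O' x y → O B (proj₁ x) (proj₁ y)
    S⊆ : ∀ {x y} → S' x y → S B (proj₁ x) (proj₁ y)
    P⊆ : ∀ {x} → P' x → P B (proj₁ x)

⟦_⟧ : ∀ {B} → Sub B → Structure
⟦_⟧ {B} A = record
  { Carrier = Σ (Carrier B) (λ x → T (Sub.U A x))
  ; O = Sub.O' A
  ; S = Sub.S' A
  ; P = Sub.P' A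
  }

-- The inclusion A ⊆ L m composed with h is a homomorphism L n → L m. Preserving S
-- forces it to be a translation i ↦ c + i; preserving P sends both endpoints 1 and n
-- to endpoints of L m, which (as n ≥ 2) forces c = 0 and n = m. So h is a section of
-- the inclusion, and then the substructure relations are squeezed between those of
-- L m and their images under h, which makes both maps isomorphisms.
module Submission where

open import Defs
open import Data.Nat using (ℕ; zero; suc; _+_; _≤_; _<_; s≤s)
open import Data.Nat.Properties using (+-identityʳ; +-suc; m+1+n≢m; m+1+n≢0; n<1+n; <-trans)
open import Data.Fin using (zero; toℕ; fromℕ; fromℕ<)
open import Data.Fin.Properties using (toℕ-fromℕ; toℕ-fromℕ<; fromℕ<-toℕ; toℕ<n; toℕ-injective)
open import Data.Bool.Properties using (T-irrelevant)
open import Data.Empty using (⊥-elim)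
open import Data.Product using (_×_; _,_; proj₁)
open import Data.Product.Properties using (Σ-≡,≡→≡)
open import Data.Sum using (inj₁; inj₂)
open import Function using (_∘_)
open import Relation.Binary.PropositionalEquality

_∘ₕ_ : ∀ {A B C} → Hom B C → Hom A B → Hom A C
g ∘ₕ f = record
  { fun   = Hom.fun g ∘ Hom.fun f
  ; presO = Hom.presO g ∘ Hom.presO f
  ; presS = Hom.presS g ∘ Hom.presS f
  ; presP = Hom.presP g ∘ Hom.presP f
  }

Iso-sym : ∀ {A B} → Iso A B → Iso B A
Iso-sym {A} {B} i = record
  { to = from ; from = to ; from∘to = to∘from ; to∘from = from∘to
  ; presO = λ o → reflO (subst₂ (O B) (sym (to∘from _)) (sym (to∘from _)) o)
  ; reflO = λ o → subst₂ (O B) (to∘from _) (to∘from _) (presO o)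
  ; presS = λ s → reflS (subst₂ (S B) (sym (to∘from _)) (sym (to∘from _)) s)
  ; reflS = λ s → subst₂ (S B) (to∘from _) (to∘from _) (presS s)
  ; presP = λ p → reflP (subst (P B) (sym (to∘from _)) p)
  ; reflP = λ p → subst (P B) (to∘from _) (presP p)
  }
  where open Iso i

module _ {B : Structure} (A : Sub B) where
  open Sub A

  inclusion : Hom ⟦ A ⟧ B
  inclusion = record { fun = proj₁ ; presO = O⊆ ; presS = S⊆ ; presP = P⊆ }

  section⇒Iso : (h : Hom B ⟦ A ⟧) → (∀ x → proj₁ (Hom.fun h x) ≡ x) → Iso B ⟦ A ⟧
  section⇒Iso h proj₁∘fun≗id = record
    { to = fun ; from = proj₁ ; from∘to = proj₁∘fun≗id ; to∘from = fun∘proj₁≗id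
    ; presO = presO
    ; reflO = λ o → subst₂ (O B) (proj₁∘fun≗id _) (proj₁∘fun≗id _) (O⊆ o)
    ; presS = presS
    ; reflS = λ s → subst₂ (S B) (proj₁∘fun≗id _) (proj₁∘fun≗id _) (S⊆ s)
    ; presP = presP
    ; reflP = λ p → subst (P B) (proj₁∘fun≗id _) (P⊆ p)
    }
    where
    open Hom h
    fun∘proj₁≗id : ∀ y → fun (proj₁ y) ≡ y
    fun∘proj₁≗id (x , x∈U) = Σ-≡,≡→≡ (proj₁∘fun≗id x , T-irrelevant _ _)

module _ {n m : ℕ} (g : Hom (L (suc n)) (L m)) where
  open Hom g

  toℕ-fun-fromℕ< : ∀ k (k<1+n : k < suc n) → toℕ (fun (fromℕ< k<1+n)) ≡ toℕ (fun zero) + k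
  toℕ-fun-fromℕ< zero    _          = sym (+-identityʳ _)
  toℕ-fun-fromℕ< (suc k) 1+k<1+n = begin
    toℕ (fun (fromℕ< 1+k<1+n))      ≡⟨ presS edge ⟩
    suc (toℕ (fun (fromℕ< k<1+n)))  ≡⟨ cong suc (toℕ-fun-fromℕ< k k<1+n) ⟩
    suc (toℕ (fun zero) + k)        ≡⟨ sym (+-suc _ k) ⟩
    toℕ (fun zero) + suc k          ∎
    where
    open ≡-Reasoning
    k<1+n : k < suc n
    k<1+n = <-trans (n<1+n k) 1+k<1+n
    edge : S (L (suc n)) (fromℕ< k<1+n) (fromℕ< 1+k<1+n)
    edge = trans (toℕ-fromℕ< 1+k<1+n) (cong suc (sym (toℕ-fromℕ< k<1+n)))

  toℕ-fun : ∀ i → toℕ (fun i) ≡ toℕ (fun zero) + toℕ i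
  toℕ-fun i = subst (λ j → toℕ (fun j) ≡ toℕ (fun zero) + toℕ i)
                    (fromℕ<-toℕ i (toℕ<n i)) (toℕ-fun-fromℕ< (toℕ i) (toℕ<n i))

Hom-L-rigid : ∀ {n m} (g : Hom (L (suc (suc n))) (L (suc m))) →
              suc n ≡ m × (∀ i → toℕ (Hom.fun g i) ≡ toℕ i)
Hom-L-rigid {n} {m} g with presP {zero} (inj₁ refl) | presP {fromℕ (suc n)} (inj₂ (toℕ-fromℕ _))
  where open Hom g
... | _           | inj₁ last↦0 = ⊥-elim (m+1+n≢0 _ (trans (sym (toℕ-fun g _)) last↦0))
... | inj₂ 0↦last | inj₂ last↦last =
  ⊥-elim (m+1+n≢m _ (trans (sym (toℕ-fun g _)) (trans last↦last (sym 0↦last))))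
... | inj₁ 0↦0    | inj₂ last↦last =
  trans (sym (trans (toℕ-fun g _) (cong₂ _+_ 0↦0 (toℕ-fromℕ _)))) last↦last ,
  λ i → trans (toℕ-fun g i) (cong (_+ toℕ i) 0↦0)

mainTheorem8 : (m : ℕ) → 1 ≤ m → (A : Sub (L m)) → (n : ℕ) → 2 ≤ n →
    Hom (L n) ⟦ A ⟧ → Iso (L n) ⟦ A ⟧ × Iso ⟦ A ⟧ (L m)
mainTheorem8 _       _ A zero          ()
mainTheorem8 _       _ A (suc zero)    (s≤s ())
mainTheorem8 (suc m) _ A (suc (suc n)) _ h with Hom-L-rigid (inclusion A ∘ₕ h)
... | refl , fun≗id = Ln≅A , Iso-sym Ln≅A
  where
  Ln≅A : Iso (L (suc (suc n))) ⟦ A ⟧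
  Ln≅A = section⇒Iso A h (λ i → toℕ-injective (fun≗id i))
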